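{- Let $n\ge 1$, $X\subseteq B^n$, and let $G=Q_n(X)$ be a daisy cube. Then every $\Theta$-class of $G$ contains an edge having the vertex $0^n$ as an endpoint.
   Context: $B=\{0,1\}$; $B^n$ is the set of binary strings of length $n$; $0^n$ is the all-zero string. $Q_n$ has vertex set $B^n$, two strings adjacent iff they differ in exactly one position. For $u,v\in B^n$ write $u\le v$ if $u_i\le v_i$ for all $i$. For $X\subseteq B^n$, the daisy cube $Q_n(X)$ is the subgraph of $Q_n$ induced by $\{u: u\le x \text{ for some } x\in X\}$. In a connected graph, edges $xy,uv$ are in relation $\Theta$ if $d(x,u)+d(y,v)\ne d(x,v)+d(y,u)$; a $\Theta$-class is an equivalence class of the transitive closure of $\Theta$. -}

module Defs where

open import Data.Bool using (Bool; true; false)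
open import Data.Nat using (ℕ; zero; suc; _+_; _<_)
open import Data.Vec using (Vec; []; _∷_; replicate)
open import Data.Vec.Relation.Binary.Pointwise.Inductive using (Pointwise)
open import Data.Product using (Σ; ∃; _×_; _,_)
open import Data.Sum using (_⊎_)
open import Data.List using (List; []; _∷_; length)
open import Relation.Binary.PropositionalEquality using (_≡_; _≢_)
open import Relation.Nullary using (¬_)
open import Relation.Binary.Construct.Closure.Transitive using (TransClosure)

B : ℕ → Set
B n = Vec Bool n

zeros : (n : ℕ) → B n
zeros n = replicate n false

data _≤ᵇ_ : Bool → Bool → Set where
  f≤b : ∀ {b} → false ≤ᵇ b
  t≤t : true ≤ᵇ true

_≼_ : ∀ {n} → B n → B n → Set
u ≼ v = Pointwise _≤ᵇ_ u v

hamming : ∀ {n} → B n → B n → ℕ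
hamming [] [] = 0
hamming (true ∷ u) (true ∷ v) = hamming u v
hamming (false ∷ u) (false ∷ v) = hamming u v
hamming (true ∷ u) (false ∷ v) = suc (hamming u v)
hamming (false ∷ u) (true ∷ v) = suc (hamming u v)

Adj : ∀ {n} → B n → B n → Set
Adj u v = hamming u v ≡ 1

Subset : ℕ → Set₁
Subset n = B n → Set

InDaisy : ∀ {n} → Subset n → B n → Set
InDaisy X u = ∃ λ x → X x × u ≼ x

data Walk {n} (X : Subset n) : B n → B n → ℕ → Set where
  stay : ∀ {u} → InDaisy X u → Walk X u u 0
  step : ∀ {u w v k} → InDaisy X u → Adj u w → Walk X w v k → Walk X u v (suc k)

Dist : ∀ {n} → Subset n → B n → B n → ℕ → Set
Dist X u v k = Walk X u v k × (∀ m → m < k → ¬ Walk X u v m)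

Edge : ∀ {n} → Subset n → Set
Edge {n} X = Σ (B n) λ x → Σ (B n) λ y → InDaisy X x × InDaisy X y × Adj x y

Θ : ∀ {n} (X : Subset n) → Edge X → Edge X → Set
Θ X (x , y , _) (u , v , _) =
  ∃ λ a → ∃ λ b → ∃ λ c → ∃ λ d →
    Dist X x u a × Dist X y v b × Dist X x v c × Dist X y u d × (a + b ≢ c + d)

-- e and f lie in the same Θ-class: transitive closure of Θ
-- (Θ is reflexive and symmetric, so this is an equivalence relation)
Θ* : ∀ {n} (X : Subset n) → Edge X → Edge X → Set
Θ* X = TransClosure (Θ X)

HasZeroEnd : ∀ {n} (X : Subset n) → Edge X → Set
HasZeroEnd {n} X (x , y , _) = (x ≡ zeros n) ⊎ (y ≡ zeros n)

module Submission where

-- Let xy be an edge of G = Q_n(X), flipping coordinate i, and let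
-- z = x ⊕ y be the unit vector of coordinate i.  Both z and 0ⁿ lie below x
-- or y, so z0ⁿ is an edge of G (G is closed downwards).  Distances in G are
-- Hamming distances (a daisy cube is an isometric subgraph of Q_n), hence,
-- writing |v| for the weight of v,
--     d(x,z) + d(y,0ⁿ) = |y| + |y|   and   d(x,0ⁿ) + d(y,z) = |x| + |x|,
-- which differ because adjacent vertices have different weights.  So xy Θ z0ⁿ.

open import Defs
open import Data.Bool using (Bool; true; false)
open import Data.Nat using (ℕ; _≥_; zero; suc; _+_; _≤_; z≤n; s≤s)
open import Data.Nat.Properties
  using (≤-refl; +-suc; +-comm; +-mono-≤; +-mono-<; <⇒≱; <⇒≢; n<1+n; suc-injective; +-commutativeSemigroup; module ≤-Reasoning)
open import Algebra.Properties.CommutativeSemigroup +-commutativeSemigroup using (interchange)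
open import Data.Product using (Σ; _×_; _,_)
open import Data.Sum using (_⊎_; inj₁; inj₂)
open import Data.Vec using ([]; _∷_)
open import Data.Vec.Relation.Binary.Pointwise.Inductive using ([]; _∷_)
open import Relation.Binary.PropositionalEquality using (_≡_; _≢_; refl; sym; trans; cong; cong₂; subst)
open import Relation.Binary.Construct.Closure.Transitive using ([_])

bitDist : Bool → Bool → ℕ
bitDist true  true  = 0
bitDist false false = 0
bitDist _     _     = 1

hamming-∷ : ∀ {n} (b c : Bool) (u v : B n) →
  hamming (b ∷ u) (c ∷ v) ≡ bitDist b c + hamming u v
hamming-∷ true  true  u v = refl
hamming-∷ true  false u v = refl
hamming-∷ false true  u v = refl
hamming-∷ false false u v = refl

hamming-self : ∀ {n} (u : B n) → hamming u u ≡ 0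
hamming-self []          = refl
hamming-self (true ∷ u)  = hamming-self u
hamming-self (false ∷ u) = hamming-self u

hamming-sym : ∀ {n} (u v : B n) → hamming u v ≡ hamming v u
hamming-sym []          []          = refl
hamming-sym (true ∷ u)  (true ∷ v)  = hamming-sym u v
hamming-sym (true ∷ u)  (false ∷ v) = cong suc (hamming-sym u v)
hamming-sym (false ∷ u) (true ∷ v)  = cong suc (hamming-sym u v)
hamming-sym (false ∷ u) (false ∷ v) = hamming-sym u v

hamming≡0⇒≡ : ∀ {n} (u v : B n) → hamming u v ≡ 0 → u ≡ v
hamming≡0⇒≡ []          []          _ = refl
hamming≡0⇒≡ (true ∷ u)  (true ∷ v)  p = cong (true ∷_) (hamming≡0⇒≡ u v p)
hamming≡0⇒≡ (false ∷ u) (false ∷ v) p = cong (false ∷_) (hamming≡0⇒≡ u v p)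

bitDist-triangle : ∀ b c d → bitDist b d ≤ bitDist b c + bitDist c d
bitDist-triangle true  true  _     = ≤-refl
bitDist-triangle false false _     = ≤-refl
bitDist-triangle true  false true  = z≤n
bitDist-triangle true  false false = s≤s z≤n
bitDist-triangle false true  true  = s≤s z≤n
bitDist-triangle false true  false = z≤n

hamming-triangle : ∀ {n} (u w v : B n) → hamming u v ≤ hamming u w + hamming w v
hamming-triangle []      []      []      = z≤n
hamming-triangle (b ∷ u) (c ∷ w) (d ∷ v) = begin
  hamming (b ∷ u) (d ∷ v)                                      ≡⟨ hamming-∷ b d u v ⟩
  bitDist b d + hamming u v                                    ≤⟨ +-mono-≤ (bitDist-triangle b c d) (hamming-triangle u w v) ⟩
  (bitDist b c + bitDist c d) + (hamming u w + hamming w v)    ≡⟨ interchange (bitDist b c) (bitDist c d) (hamming u w) (hamming w v) ⟩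
  (bitDist b c + hamming u w) + (bitDist c d + hamming w v)    ≡⟨ sym (cong₂ _+_ (hamming-∷ b c u w) (hamming-∷ c d w v)) ⟩
  hamming (b ∷ u) (c ∷ w) + hamming (c ∷ w) (d ∷ v)            ∎
  where open ≤-Reasoning

weight : ∀ {n} → B n → ℕ
weight {n} u = hamming u (zeros n)

weight-adjacent : ∀ {n} (x y : B n) → Adj x y →
  weight x ≡ suc (weight y) ⊎ weight y ≡ suc (weight x)
weight-adjacent []          []          ()
weight-adjacent (true ∷ u)  (true ∷ v)  e with weight-adjacent u v e
... | inj₁ p = inj₁ (cong suc p)
... | inj₂ p = inj₂ (cong suc p)
weight-adjacent (false ∷ u) (false ∷ v) e = weight-adjacent u v e
weight-adjacent (true ∷ u)  (false ∷ v) e with hamming≡0⇒≡ u v (suc-injective e)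
... | refl = inj₁ refl
weight-adjacent (false ∷ u) (true ∷ v)  e with hamming≡0⇒≡ u v (suc-injective e)
... | refl = inj₂ refl

≼-refl : ∀ {n} (u : B n) → u ≼ u
≼-refl []          = []
≼-refl (true ∷ u)  = t≤t ∷ ≼-refl u
≼-refl (false ∷ u) = f≤b ∷ ≼-refl u

≼-trans : ∀ {n} {u v w : B n} → u ≼ v → v ≼ w → u ≼ w
≼-trans []         []        = []
≼-trans (f≤b ∷ p) (_ ∷ q)   = f≤b ∷ ≼-trans p q
≼-trans (t≤t ∷ p) (t≤t ∷ q) = t≤t ∷ ≼-trans p q

zeros-least : ∀ {n} (u : B n) → zeros n ≼ u
zeros-least []      = []
zeros-least (_ ∷ u) = f≤b ∷ zeros-least u

daisy-down : ∀ {n} {X : Subset n} {u v : B n} → u ≼ v → InDaisy X v → InDaisy X u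
daisy-down u≼v (x , Xx , v≼x) = x , Xx , ≼-trans u≼v v≼x

meet : ∀ {n} → B n → B n → B n
meet []          []          = []
meet (true ∷ u)  (true ∷ v)  = true ∷ meet u v
meet (true ∷ u)  (false ∷ v) = false ∷ meet u v
meet (false ∷ u) (_ ∷ v)     = false ∷ meet u v

meet-≼ˡ : ∀ {n} (u v : B n) → meet u v ≼ u
meet-≼ˡ []          []          = []
meet-≼ˡ (true ∷ u)  (true ∷ v)  = t≤t ∷ meet-≼ˡ u v
meet-≼ˡ (true ∷ u)  (false ∷ v) = f≤b ∷ meet-≼ˡ u v
meet-≼ˡ (false ∷ u) (_ ∷ v)     = f≤b ∷ meet-≼ˡ u v

meet-≼ʳ : ∀ {n} (u v : B n) → meet u v ≼ v
meet-≼ʳ []          []          = []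
meet-≼ʳ (true ∷ u)  (true ∷ v)  = t≤t ∷ meet-≼ʳ u v
meet-≼ʳ (true ∷ u)  (false ∷ v) = f≤b ∷ meet-≼ʳ u v
meet-≼ʳ (false ∷ u) (_ ∷ v)     = f≤b ∷ meet-≼ʳ u v

hamming-via-meet : ∀ {n} (u v : B n) →
  hamming u v ≡ hamming u (meet u v) + hamming v (meet u v)
hamming-via-meet []          []          = refl
hamming-via-meet (true ∷ u)  (true ∷ v)  = hamming-via-meet u v
hamming-via-meet (true ∷ u)  (false ∷ v) = cong suc (hamming-via-meet u v)
hamming-via-meet (false ∷ u) (true ∷ v)  =
  trans (cong suc (hamming-via-meet u v)) (sym (+-suc _ _))
hamming-via-meet (false ∷ u) (false ∷ v) = hamming-via-meet u v

descent-step : ∀ {n} (u w : B n) {k} → w ≼ u → hamming u w ≡ suc k →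
  Σ (B n) λ u′ → w ≼ u′ × u′ ≼ u × Adj u u′ × hamming u′ w ≡ k
descent-step (true ∷ u) (false ∷ w) (f≤b ∷ p) e =
  false ∷ u , f≤b ∷ p , f≤b ∷ ≼-refl u , cong suc (hamming-self u) , suc-injective e
descent-step (true ∷ u) (true ∷ w) (t≤t ∷ p) e with descent-step u w p e
... | u′ , w≼u′ , u′≼u , adj , dist = true ∷ u′ , t≤t ∷ w≼u′ , t≤t ∷ u′≼u , adj , dist
descent-step (false ∷ u) (false ∷ w) (f≤b ∷ p) e with descent-step u w p e
... | u′ , w≼u′ , u′≼u , adj , dist = false ∷ u′ , f≤b ∷ w≼u′ , f≤b ∷ u′≼u , adj , dist

walk-source : ∀ {n} {X : Subset n} {u v k} → Walk X u v k → InDaisy X u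
walk-source (stay du)     = du
walk-source (step du _ _) = du

append : ∀ {n} {X : Subset n} {u m v k l} → Walk X u m k → Walk X m v l → Walk X u v (k + l)
append (stay _)      q = q
append (step du a p) q = step du a (append p q)

reverse : ∀ {n} {X : Subset n} {u v k} → Walk X u v k → Walk X v u k
reverse (stay du) = stay du
reverse {k = suc k} (step {u = u} {w = w} du adj p) =
  subst (Walk _ _ u) (+-comm k 1)
    (append (reverse p) (step (walk-source p) (trans (hamming-sym w u) adj) (stay du)))

walk-length-≥ : ∀ {n} {X : Subset n} {u v k} → Walk X u v k → hamming u v ≤ k
walk-length-≥ {u = u} (stay _) = subst (_≤ 0) (sym (hamming-self u)) z≤n
walk-length-≥ {u = u} {v} (step {w = w} _ adj p) = begin
  hamming u v                ≤⟨ hamming-triangle u w v ⟩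
  hamming u w + hamming w v  ≡⟨ cong (_+ hamming w v) adj ⟩
  suc (hamming w v)          ≤⟨ s≤s (walk-length-≥ p) ⟩
  suc _                      ∎
  where open ≤-Reasoning

descent : ∀ {n} {X : Subset n} k (u w : B n) → w ≼ u → hamming u w ≡ k →
  InDaisy X u → Walk X u w k
descent zero u w _ e du with hamming≡0⇒≡ u w e
... | refl = stay du
descent (suc k) u w w≼u e du with descent-step u w w≼u e
... | u′ , w≼u′ , u′≼u , adj , dist = step du adj (descent k u′ w w≼u′ dist (daisy-down u′≼u du))

geodesic : ∀ {n} {X : Subset n} (u v : B n) → InDaisy X u → InDaisy X v →
  Walk X u v (hamming u v)
geodesic u v du dv = subst (Walk _ u v) (sym (hamming-via-meet u v))
  (append (descent _ u (meet u v) (meet-≼ˡ u v) refl du)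
          (reverse (descent _ v (meet u v) (meet-≼ʳ u v) refl dv)))

dist-hamming : ∀ {n} {X : Subset n} (u v : B n) → InDaisy X u → InDaisy X v →
  Dist X u v (hamming u v)
dist-hamming u v du dv = geodesic u v du dv , λ m m<h w → <⇒≱ m<h (walk-length-≥ w)

xor : ∀ {n} → B n → B n → B n
xor []          []          = []
xor (true ∷ u)  (true ∷ v)  = false ∷ xor u v
xor (false ∷ u) (false ∷ v) = false ∷ xor u v
xor (true ∷ u)  (false ∷ v) = true ∷ xor u v
xor (false ∷ u) (true ∷ v)  = true ∷ xor u v

xor-dist-left : ∀ {n} (x y : B n) → hamming x (xor x y) ≡ weight y
xor-dist-left []          []          = refl
xor-dist-left (true ∷ u)  (true ∷ v)  = cong suc (xor-dist-left u v)
xor-dist-left (false ∷ u) (false ∷ v) = xor-dist-left u v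
xor-dist-left (true ∷ u)  (false ∷ v) = xor-dist-left u v
xor-dist-left (false ∷ u) (true ∷ v)  = cong suc (xor-dist-left u v)

xor-dist-right : ∀ {n} (x y : B n) → hamming y (xor x y) ≡ weight x
xor-dist-right []          []          = refl
xor-dist-right (true ∷ u)  (true ∷ v)  = cong suc (xor-dist-right u v)
xor-dist-right (false ∷ u) (false ∷ v) = xor-dist-right u v
xor-dist-right (true ∷ u)  (false ∷ v) = cong suc (xor-dist-right u v)
xor-dist-right (false ∷ u) (true ∷ v)  = xor-dist-right u v

xor-weight : ∀ {n} (x y : B n) → weight (xor x y) ≡ hamming x y
xor-weight []          []          = refl
xor-weight (true ∷ u)  (true ∷ v)  = xor-weight u v
xor-weight (false ∷ u) (false ∷ v) = xor-weight u v
xor-weight (true ∷ u)  (false ∷ v) = cong suc (xor-weight u v)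
xor-weight (false ∷ u) (true ∷ v)  = cong suc (xor-weight u v)

xor-self : ∀ {n} (u : B n) → xor u u ≡ zeros n
xor-self []          = refl
xor-self (true ∷ u)  = cong (false ∷_) (xor-self u)
xor-self (false ∷ u) = cong (false ∷_) (xor-self u)

xor-below-edge : ∀ {n} (x y : B n) → Adj x y → xor x y ≼ x ⊎ xor x y ≼ y
xor-below-edge []          []          ()
xor-below-edge (true ∷ u)  (true ∷ v)  e with xor-below-edge u v e
... | inj₁ p = inj₁ (f≤b ∷ p)
... | inj₂ p = inj₂ (f≤b ∷ p)
xor-below-edge (false ∷ u) (false ∷ v) e with xor-below-edge u v e
... | inj₁ p = inj₁ (f≤b ∷ p)
... | inj₂ p = inj₂ (f≤b ∷ p)
xor-below-edge (true ∷ u)  (false ∷ v) e with hamming≡0⇒≡ u v (suc-injective e)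
... | refl = inj₁ (t≤t ∷ subst (_≼ u) (sym (xor-self u)) (zeros-least u))
xor-below-edge (false ∷ u) (true ∷ v)  e with hamming≡0⇒≡ u v (suc-injective e)
... | refl = inj₂ (t≤t ∷ subst (_≼ u) (sym (xor-self u)) (zeros-least u))

-- The Θ-defining inequality for xy and (x ⊕ y)0ⁿ, in terms of weights.
double-weight-differs : ∀ {n} (x y : B n) → Adj x y → weight y + weight y ≢ weight x + weight x
double-weight-differs x y adj with weight-adjacent x y adj
... | inj₁ p rewrite p = <⇒≢ (+-mono-< (n<1+n _) (n<1+n _))
... | inj₂ p rewrite p = λ e → <⇒≢ (+-mono-< (n<1+n _) (n<1+n _)) (sym e)

proposition2p2 : (n : ℕ) → n ≥ 1 → (X : Subset n) →
    (e : Edge X) → Σ (Edge X) (λ f → HasZeroEnd X f × Θ* X e f)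
proposition2p2 n _ X (x , y , dx , dy , adj) =
  (z , zeros n , dz , d0 , trans (xor-weight x y) adj) , inj₂ refl ,
  [ (_ , _ , _ , _ , dist-hamming x z dx dz , dist-hamming y (zeros n) dy d0 ,
     dist-hamming x (zeros n) dx d0 , dist-hamming y z dy dz , Θ-inequality) ]
  where
  z = xor x y
  dz : InDaisy X z
  dz with xor-below-edge x y adj
  ... | inj₁ z≼x = daisy-down z≼x dx
  ... | inj₂ z≼y = daisy-down z≼y dy
  d0 : InDaisy X (zeros n)
  d0 = daisy-down (zeros-least x) dx
  Θ-inequality : hamming x z + weight y ≢ weight x + hamming y z
  Θ-inequality rewrite xor-dist-left x y | xor-dist-right x y = double-weight-differs x y adj
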